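{- Let $G=(V,E)$ be a simple graph. For any $\mathbf{d}\in\mathbb{N}^{V}$, the non-zero invariant factors of $A(G)$ are equal to the non-zero invariant factors of $A(G^{\mathbf{d}})$.
   Context: $A(G)$ is the adjacency matrix; invariant factors are the diagonal entries of the Smith normal form over $\mathbb{Z}$. $\mathbb{N}$ denotes the positive integers. For $\mathbf{d}\in\mathbb{N}^V$, $G^{\mathbf{d}}$ is obtained by replacing each vertex $u$ by a stable set $V_u$ of size $\mathbf{d}_u$, where a vertex of $V_u$ is adjacent to a vertex of $V_v$ iff $uv\in E$. -}

module Defs where

open import Data.Nat using (ℕ; zero; suc; _≤_)
import Data.Nat as ℕ
open import Data.Nat.Divisibility using (_∣_)
open import Data.Integer using (ℤ; +_; _+_; _*_)
open import Data.Fin using (Fin; zero; suc; toℕ; splitAt)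
open import Data.Bool using (Bool; true; false; if_then_else_)
open import Data.Sum using (inj₁; inj₂)
open import Data.Product using (Σ; _×_; ∃; ∃-syntax; _,_)
open import Data.List using (List; length; lookup)
open import Data.Maybe using (Maybe; just; nothing)
open import Data.List.Relation.Unary.All using (All)
open import Data.List.Relation.Unary.Linked using (Linked)
open import Relation.Binary.PropositionalEquality using (_≡_)
open import Relation.Nullary using (yes; no)

record SimpleGraph (n : ℕ) : Set where
  field
    adj   : Fin n → Fin n → Bool
    sym   : ∀ u v → adj u v ≡ adj v u
    irrefl : ∀ u → adj u u ≡ false
open SimpleGraph public

Mat : ℕ → Set
Mat n = Fin n → Fin n → ℤ

sumℤ : ∀ {n} → (Fin n → ℤ) → ℤ
sumℤ {zero} f = + 0
sumℤ {suc n} f = f zero + sumℤ (λ i → f (suc i))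

_⊗_ : ∀ {n} → Mat n → Mat n → Mat n
(A ⊗ B) i j = sumℤ (λ k → A i k * B k j)

idMat : ∀ {n} → Mat n
idMat i j with toℕ i ℕ.≟ toℕ j
... | yes _ = + 1
... | no  _ = + 0

Unimodular : ∀ {n} → Mat n → Set
Unimodular {n} P = Σ (Mat n) λ P' → (∀ i j → (P ⊗ P') i j ≡ idMat i j) × (∀ i j → (P' ⊗ P) i j ≡ idMat i j)

nth0 : List ℕ → ℕ → ℕ
nth0 Data.List.[] _ = 0
nth0 (x Data.List.∷ xs) zero = x
nth0 (x Data.List.∷ xs) (suc k) = nth0 xs k

-- diagonal matrix diag(d₁,…,d_r,0,…,0)
diagMat : ∀ {n} → List ℕ → Mat n
diagMat ds i j with toℕ i ℕ.≟ toℕ j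
... | yes _ = + nth0 ds (toℕ i)
... | no  _ = + 0

-- ds is the list of non-zero invariant factors of A: there are unimodular P, Q
-- with P A Q = diag(d₁,…,d_r,0,…,0) (Smith normal form), dᵢ > 0, d₁ ∣ d₂ ∣ … ∣ d_r.
NonzeroInvariantFactors : ∀ {n} → Mat n → List ℕ → Set
NonzeroInvariantFactors {n} A ds =
  length ds ≤ n × All (λ d → 1 ≤ d) ds × Linked _∣_ ds ×
  ∃[ P ] ∃[ Q ] (Unimodular P × Unimodular Q ×
     (∀ i j → ((P ⊗ A) ⊗ Q) i j ≡ diagMat ds i j))

adjMat : ∀ {n} → SimpleGraph n → Mat n
adjMat G u v = if adj G u v then + 1 else + 0

total : ∀ {n} → (Fin n → ℕ) → ℕ
total {zero} d = 0
total {suc n} d = d zero ℕ.+ total (λ u → d (suc u))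

-- the vertex of G whose class V_u contains a given vertex of G^d
-- (vertices of G^d are Fin (total d), listed as V_0, V_1, … consecutively)
owner : ∀ {n} (d : Fin n → ℕ) → Fin (total d) → Fin n
owner {suc n} d i with splitAt (d zero) i
... | inj₁ _ = zero
... | inj₂ j = suc (owner (λ u → d (suc u)) j)

blowUp : ∀ {n} → SimpleGraph n → (d : Fin n → ℕ) → SimpleGraph (total d)
blowUp G d = record
  { adj = λ x y → adj G (owner d x) (owner d y)
  ; sym = λ x y → sym G (owner d x) (owner d y)
  ; irrefl = λ x → irrefl G (owner d x) }

-- The blow-up G^d arises from G by repeatedly duplicating a vertex, and its adjacency matrix is A(G)
-- reindexed along the map sending every copy to its original. Duplicating an index creates two equal
-- rows and columns; subtracting one copy from the other shows that the new matrix is equivalent to 0 ⊕ A.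
-- So it suffices that a zero border does not change the non-zero invariant factors. If
-- P (0 ⊕ A) Q = diag(0, d₁, …), the first row w of P⁻¹ is primitive and vanishes wherever the diagonal
-- does not. Completing w to a unimodular matrix by the Euclidean algorithm, touching only coordinates
-- where w is non-zero, normalises the first row of P (and, after transposing, the first column of Q)
-- without changing the diagonal matrix; the border then splits off.

module Submission where

open import Defs hiding (sym)
open import Level using (0ℓ)
open import Data.Nat using (ℕ; zero; suc; s≤s; _≤_)
import Data.Nat as ℕ
import Data.Nat.Properties as ℕ
open import Data.Fin using (Fin; zero; suc; toℕ; fromℕ; punchIn; pinch; inject₁; lift; splitAt)
import Data.Fin.Properties as Fin
open import Data.Integer using (ℤ; +_; _+_; _*_; -_; -1ℤ; ∣_∣; _/_; _%_; NonZero; ≢-nonZero; _≟_)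
open import Data.Integer.DivMod using (a≡a%n+[a/n]*n; n%d<d)
open import Data.Integer.Tactic.RingSolver using (solve-∀)
open import Data.Integer.Properties
open import Algebra.Properties.Semiring.Sum +-*-semiring using (sum; sum-cong-≗; sum-remove; ∑-distrib-+; ∑-comm; *-distribˡ-sum; *-distribʳ-sum)
open import Data.List using (List; []; _∷_; length)
open import Data.List.Relation.Unary.All using (All; []; _∷_)
open import Function.Bundles using (_⇔_; mk⇔)
open import Data.Product using (_,_; _×_; ∃-syntax; proj₁; proj₂)
open import Data.Empty using (⊥-elim)
open import Data.Fin.Permutation as Perm using (Permutation′; _⟨$⟩ʳ_; _⟨$⟩ˡ_)
open import Function using (id; _∘′_)
open import Data.Sum using (inj₁; inj₂; [_,_]′)
open import Function.Construct.Composition using (_⇔-∘_)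
open import Function.Construct.Symmetry using (⇔-sym)
open import Function.Construct.Identity using (⇔-id)
open import Data.Vec.Functional using (removeAt) renaming (_∷_ to _∷ᵥ_)
open import Relation.Nullary using (¬_; yes; no)
open import Relation.Binary.Bundles using (Setoid)
open import Relation.Binary.PropositionalEquality
import Relation.Binary.Reasoning.Setoid as SetoidReasoning

sumℤ≡sum : ∀ {n} (f : Fin n → ℤ) → sumℤ f ≡ sum f
sumℤ≡sum {zero}  f = refl
sumℤ≡sum {suc n} f = cong (_+_ (f zero)) (sumℤ≡sum (λ i → f (suc i)))

sumℤ-cong : ∀ {n} {f g : Fin n → ℤ} → (∀ i → f i ≡ g i) → sumℤ f ≡ sumℤ g
sumℤ-cong {zero}  f≗g = refl
sumℤ-cong {suc n} f≗g = cong₂ _+_ (f≗g zero) (sumℤ-cong (λ i → f≗g (suc i)))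

sumℤ-zero : ∀ {n} (f : Fin n → ℤ) → (∀ i → f i ≡ + 0) → sumℤ f ≡ + 0
sumℤ-zero {zero}  f f≗0 = refl
sumℤ-zero {suc n} f f≗0 = cong₂ _+_ (f≗0 zero) (sumℤ-zero (λ i → f (suc i)) (λ i → f≗0 (suc i)))

sumℤ-remove : ∀ {n} (i : Fin (suc n)) (f : Fin (suc n) → ℤ) → sumℤ f ≡ f i + sumℤ (removeAt f i)
sumℤ-remove i f = begin
  sumℤ f                      ≡⟨ sumℤ≡sum f ⟩
  sum f                       ≡⟨ sum-remove f ⟩
  f i + sum (removeAt f i)    ≡⟨ cong (_+_ (f i)) (sym (sumℤ≡sum (removeAt f i))) ⟩
  f i + sumℤ (removeAt f i)   ∎
  where open ≡-Reasoning

sumℤ-distrib-+ : ∀ {n} (f g : Fin n → ℤ) → sumℤ (λ i → f i + g i) ≡ sumℤ f + sumℤ g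
sumℤ-distrib-+ f g = begin
  sumℤ (λ i → f i + g i) ≡⟨ sumℤ≡sum (λ i → f i + g i) ⟩
  sum (λ i → f i + g i)  ≡⟨ ∑-distrib-+ f g ⟩
  sum f + sum g          ≡⟨ sym (cong₂ _+_ (sumℤ≡sum f) (sumℤ≡sum g)) ⟩
  sumℤ f + sumℤ g        ∎
  where open ≡-Reasoning

*-distribˡ-sumℤ : ∀ {n} c (f : Fin n → ℤ) → c * sumℤ f ≡ sumℤ (λ i → c * f i)
*-distribˡ-sumℤ c f = begin
  c * sumℤ f             ≡⟨ cong (c *_) (sumℤ≡sum f) ⟩
  c * sum f              ≡⟨ *-distribˡ-sum c f ⟩
  sum (λ i → c * f i)    ≡⟨ sym (sumℤ≡sum (λ i → c * f i)) ⟩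
  sumℤ (λ i → c * f i)   ∎
  where open ≡-Reasoning

*-distribʳ-sumℤ : ∀ {n} c (f : Fin n → ℤ) → sumℤ f * c ≡ sumℤ (λ i → f i * c)
*-distribʳ-sumℤ c f = begin
  sumℤ f * c             ≡⟨ cong (_* c) (sumℤ≡sum f) ⟩
  sum f * c              ≡⟨ *-distribʳ-sum c f ⟩
  sum (λ i → f i * c)    ≡⟨ sym (sumℤ≡sum (λ i → f i * c)) ⟩
  sumℤ (λ i → f i * c)   ∎
  where open ≡-Reasoning

sumℤ-comm : ∀ {m n} (f : Fin m → Fin n → ℤ) →
  sumℤ (λ i → sumℤ (λ j → f i j)) ≡ sumℤ (λ j → sumℤ (λ i → f i j))
sumℤ-comm f = begin
  sumℤ (λ i → sumℤ (f i))            ≡⟨ trans (sumℤ≡sum (λ i → sumℤ (f i))) (sum-cong-≗ (λ i → sumℤ≡sum (f i))) ⟩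
  sum (λ i → sum (f i))              ≡⟨ ∑-comm f ⟩
  sum (λ j → sum (λ i → f i j))      ≡⟨ sym (trans (sumℤ≡sum (λ j → sumℤ (λ i → f i j))) (sum-cong-≗ (λ j → sumℤ≡sum (λ i → f i j)))) ⟩
  sumℤ (λ j → sumℤ (λ i → f i j))    ∎
  where open ≡-Reasoning

δ : ∀ {n} → Fin n → Fin n → ℤ
δ zero    zero    = + 1
δ zero    (suc j) = + 0
δ (suc i) zero    = + 0
δ (suc i) (suc j) = δ i j

δ-refl : ∀ {n} (i : Fin n) → δ i i ≡ + 1
δ-refl zero    = refl
δ-refl (suc i) = δ-refl i

δ-≢ : ∀ {n} {i j : Fin n} → i ≢ j → δ i j ≡ + 0
δ-≢ {i = zero}  {zero}  i≢j = ⊥-elim (i≢j refl)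
δ-≢ {i = zero}  {suc j} i≢j = refl
δ-≢ {i = suc i} {zero}  i≢j = refl
δ-≢ {i = suc i} {suc j} i≢j = δ-≢ (i≢j ∘′ cong suc)

δ-sym : ∀ {n} (i j : Fin n) → δ i j ≡ δ j i
δ-sym zero    zero    = refl
δ-sym zero    (suc j) = refl
δ-sym (suc i) zero    = refl
δ-sym (suc i) (suc j) = δ-sym i j

δ-*-swap : ∀ {n} (f : Fin n → ℤ) (i j : Fin n) → δ i j * f i ≡ δ i j * f j
δ-*-swap f i j with i Fin.≟ j
... | yes refl = refl
... | no  i≢j  = trans (cong (_* f i) (δ-≢ i≢j)) (sym (cong (_* f j) (δ-≢ i≢j)))

idMat-δ : ∀ {n} (i j : Fin n) → idMat i j ≡ δ i j
idMat-δ i j with toℕ i ℕ.≟ toℕ j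
... | yes i≡j = sym (trans (cong (δ i) (sym (Fin.toℕ-injective i≡j))) (δ-refl i))
... | no  i≢j = sym (δ-≢ (i≢j ∘′ cong toℕ))

sumℤ-δˡ : ∀ {n} (a : Fin n) (f : Fin n → ℤ) → sumℤ (λ k → δ a k * f k) ≡ f a
sumℤ-δˡ zero    f = trans (cong₂ _+_ (*-identityˡ (f zero)) (sumℤ-zero (λ k → δ zero (suc k) * f (suc k)) (λ k → refl)))
                          (+-identityʳ (f zero))
sumℤ-δˡ (suc a) f = trans (+-identityˡ _) (sumℤ-δˡ a (λ k → f (suc k)))

sumℤ-δʳ : ∀ {n} (a : Fin n) (f : Fin n → ℤ) → sumℤ (λ k → f k * δ k a) ≡ f a
sumℤ-δʳ a f = trans (sumℤ-cong (λ k → trans (*-comm (f k) _) (cong (_* f k) (δ-sym k a)))) (sumℤ-δˡ a f)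

⟨_,_⟩ : ∀ {n} → (Fin n → ℤ) → (Fin n → ℤ) → ℤ
⟨ x , y ⟩ = sumℤ (λ i → x i * y i)

⟨⟩-removeAt : ∀ {n} (i : Fin (suc n)) (x y : Fin (suc n) → ℤ) → x i ≡ + 0 →
  ⟨ x , y ⟩ ≡ ⟨ removeAt x i , removeAt y i ⟩
⟨⟩-removeAt i x y xᵢ≡0 = begin
  ⟨ x , y ⟩                                  ≡⟨ sumℤ-remove i (λ k → x k * y k) ⟩
  x i * y i + ⟨ removeAt x i , removeAt y i ⟩  ≡⟨ cong (λ xᵢ → xᵢ * y i + ⟨ removeAt x i , removeAt y i ⟩) xᵢ≡0 ⟩
  + 0 * y i + ⟨ removeAt x i , removeAt y i ⟩  ≡⟨ +-identityˡ _ ⟩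
  ⟨ removeAt x i , removeAt y i ⟩            ∎
  where open ≡-Reasoning

infixl 7 _ᵥ⊗_
infixr 7 _⊗ᵥ_

_ᵥ⊗_ : ∀ {n} → (Fin n → ℤ) → Mat n → Fin n → ℤ
(w ᵥ⊗ U) j = sumℤ (λ i → w i * U i j)

_⊗ᵥ_ : ∀ {n} → Mat n → (Fin n → ℤ) → Fin n → ℤ
(U ⊗ᵥ z) i = sumℤ (λ k → U i k * z k)

⟨⟩-comm : ∀ {n} (x y : Fin n → ℤ) → ⟨ x , y ⟩ ≡ ⟨ y , x ⟩
⟨⟩-comm x y = sumℤ-cong (λ i → *-comm (x i) (y i))

ᵥ⊗-congˡ : ∀ {n} {w w′ : Fin n → ℤ} (U : Mat n) → (∀ i → w i ≡ w′ i) → ∀ j → (w ᵥ⊗ U) j ≡ (w′ ᵥ⊗ U) j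
ᵥ⊗-congˡ U w≗w′ j = sumℤ-cong (λ i → cong (_* U i j) (w≗w′ i))

ᵥ⊗-unit-column : ∀ {n} (w : Fin n → ℤ) (U : Mat n) j → (∀ i → U i j ≡ δ i j) → (w ᵥ⊗ U) j ≡ w j
ᵥ⊗-unit-column w U j column≗δ = trans (sumℤ-cong (λ i → cong (w i *_) (column≗δ i))) (sumℤ-δʳ j w)

ᵥ⊗-idMat : ∀ {n} (w : Fin n → ℤ) j → (w ᵥ⊗ idMat) j ≡ w j
ᵥ⊗-idMat w j = ᵥ⊗-unit-column w idMat j (λ i → idMat-δ i j)

⊗ᵥ-idMat : ∀ {n} (z : Fin n → ℤ) i → (idMat ⊗ᵥ z) i ≡ z i
⊗ᵥ-idMat z i = trans (sumℤ-cong (λ k → cong (_* z k) (idMat-δ i k))) (sumℤ-δˡ i z)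

ᵥ⊗-assoc : ∀ {n} (w : Fin n → ℤ) (A B : Mat n) j → (w ᵥ⊗ (A ⊗ B)) j ≡ ((w ᵥ⊗ A) ᵥ⊗ B) j
ᵥ⊗-assoc w A B j = begin
  sumℤ (λ i → w i * sumℤ (λ k → A i k * B k j))
    ≡⟨ sumℤ-cong (λ i → *-distribˡ-sumℤ (w i) (λ k → A i k * B k j)) ⟩
  sumℤ (λ i → sumℤ (λ k → w i * (A i k * B k j)))
    ≡⟨ sumℤ-cong (λ i → sumℤ-cong (λ k → sym (*-assoc (w i) (A i k) (B k j)))) ⟩
  sumℤ (λ i → sumℤ (λ k → w i * A i k * B k j))
    ≡⟨ sumℤ-comm (λ i k → w i * A i k * B k j) ⟩
  sumℤ (λ k → sumℤ (λ i → w i * A i k * B k j))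
    ≡⟨ sumℤ-cong (λ k → sym (*-distribʳ-sumℤ (B k j) (λ i → w i * A i k))) ⟩
  sumℤ (λ k → (w ᵥ⊗ A) k * B k j) ∎
  where open ≡-Reasoning

⟨⟩-ᵥ⊗ : ∀ {n} (w : Fin n → ℤ) (U : Mat n) (y : Fin n → ℤ) → ⟨ w ᵥ⊗ U , y ⟩ ≡ ⟨ w , U ⊗ᵥ y ⟩
⟨⟩-ᵥ⊗ w U y = begin
  sumℤ (λ j → sumℤ (λ i → w i * U i j) * y j)
    ≡⟨ sumℤ-cong (λ j → *-distribʳ-sumℤ (y j) (λ i → w i * U i j)) ⟩
  sumℤ (λ j → sumℤ (λ i → w i * U i j * y j))
    ≡⟨ sumℤ-comm (λ j i → w i * U i j * y j) ⟩
  sumℤ (λ i → sumℤ (λ j → w i * U i j * y j))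
    ≡⟨ sumℤ-cong (λ i → sumℤ-cong (λ j → *-assoc (w i) (U i j) (y j))) ⟩
  sumℤ (λ i → sumℤ (λ j → w i * (U i j * y j)))
    ≡⟨ sumℤ-cong (λ i → sym (*-distribˡ-sumℤ (w i) (λ j → U i j * y j))) ⟩
  sumℤ (λ i → w i * (U ⊗ᵥ y) i) ∎
  where open ≡-Reasoning

infix 4 _≐_ _∼_

_≐_ : ∀ {n} → Mat n → Mat n → Set
A ≐ B = ∀ i j → A i j ≡ B i j

≐-refl : ∀ {n} {A : Mat n} → A ≐ A
≐-refl i j = refl

≐-sym : ∀ {n} {A B : Mat n} → A ≐ B → B ≐ A
≐-sym A≐B i j = sym (A≐B i j)

≐-trans : ∀ {n} {A B C : Mat n} → A ≐ B → B ≐ C → A ≐ C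
≐-trans A≐B B≐C i j = trans (A≐B i j) (B≐C i j)

≐-setoid : ℕ → Setoid 0ℓ 0ℓ
≐-setoid n = record
  { Carrier = Mat n ; _≈_ = _≐_
  ; isEquivalence = record { refl = ≐-refl ; sym = ≐-sym ; trans = ≐-trans } }

module ≐-Reasoning {n} = SetoidReasoning (≐-setoid n)

⊗-cong : ∀ {n} {A A′ B B′ : Mat n} → A ≐ A′ → B ≐ B′ → A ⊗ B ≐ A′ ⊗ B′
⊗-cong A≐A′ B≐B′ i j = sumℤ-cong (λ k → cong₂ _*_ (A≐A′ i k) (B≐B′ k j))

⊗-congˡ : ∀ {n} {A A′ : Mat n} (B : Mat n) → A ≐ A′ → A ⊗ B ≐ A′ ⊗ B
⊗-congˡ B A≐A′ = ⊗-cong A≐A′ (≐-refl {A = B})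

⊗-congʳ : ∀ {n} (A : Mat n) {B B′ : Mat n} → B ≐ B′ → A ⊗ B ≐ A ⊗ B′
⊗-congʳ A = ⊗-cong (≐-refl {A = A})

⊗-assoc : ∀ {n} (A B C : Mat n) → (A ⊗ B) ⊗ C ≐ A ⊗ (B ⊗ C)
⊗-assoc A B C i j = sym (ᵥ⊗-assoc (A i) B C j)

⊗-identityˡ : ∀ {n} (A : Mat n) → idMat ⊗ A ≐ A
⊗-identityˡ A i j = ⊗ᵥ-idMat (λ k → A k j) i

⊗-identityʳ : ∀ {n} (A : Mat n) → A ⊗ idMat ≐ A
⊗-identityʳ A i j = ᵥ⊗-idMat (A i) j

⊗ᵥ-inverse : ∀ {n} (U U′ : Mat n) (z : Fin n → ℤ) → U ⊗ U′ ≐ idMat → ∀ i → (U ⊗ᵥ (U′ ⊗ᵥ z)) i ≡ z i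
⊗ᵥ-inverse U U′ z UU′≐I i = begin
  (U ⊗ᵥ (U′ ⊗ᵥ z)) i    ≡⟨ sym (⟨⟩-ᵥ⊗ (U i) U′ z) ⟩
  ((U ⊗ U′) ⊗ᵥ z) i     ≡⟨ sumℤ-cong (λ k → cong (_* z k) (UU′≐I i k)) ⟩
  (idMat ⊗ᵥ z) i        ≡⟨ ⊗ᵥ-idMat z i ⟩
  z i                   ∎
  where open ≡-Reasoning

⟨⟩-unimodular : ∀ {n} (w z : Fin n → ℤ) (U U′ : Mat n) → U ⊗ U′ ≐ idMat → ⟨ w ᵥ⊗ U , U′ ⊗ᵥ z ⟩ ≡ ⟨ w , z ⟩
⟨⟩-unimodular w z U U′ UU′≐I = trans (⟨⟩-ᵥ⊗ w U (U′ ⊗ᵥ z)) (sumℤ-cong (λ i → cong (w i *_) (⊗ᵥ-inverse U U′ z UU′≐I i)))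

Unimodular-idMat : ∀ {n} → Unimodular {n} idMat
Unimodular-idMat = idMat , ⊗-identityˡ idMat , ⊗-identityˡ idMat

Unimodular-inverse : ∀ {n} (P : Mat n) (P-unimodular : Unimodular P) → Unimodular (proj₁ P-unimodular)
Unimodular-inverse P (P′ , PP′≐I , P′P≐I) = P , P′P≐I , PP′≐I

Unimodular-resp-≐ : ∀ {n} (P Q : Mat n) → P ≐ Q → Unimodular P → Unimodular Q
Unimodular-resp-≐ P Q P≐Q (P′ , PP′≐I , P′P≐I) =
  P′ , ≐-trans (⊗-congˡ P′ (≐-sym P≐Q)) PP′≐I , ≐-trans (⊗-congʳ P′ (≐-sym P≐Q)) P′P≐I

⊗-inverse : ∀ {n} (A A′ B B′ : Mat n) → A ⊗ A′ ≐ idMat → B ⊗ B′ ≐ idMat → (A ⊗ B) ⊗ (B′ ⊗ A′) ≐ idMat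
⊗-inverse A A′ B B′ AA′≐I BB′≐I = begin
  (A ⊗ B) ⊗ (B′ ⊗ A′)  ≈⟨ ⊗-assoc A B (B′ ⊗ A′) ⟩
  A ⊗ (B ⊗ (B′ ⊗ A′))  ≈⟨ ⊗-congʳ A (≐-sym (⊗-assoc B B′ A′)) ⟩
  A ⊗ ((B ⊗ B′) ⊗ A′)  ≈⟨ ⊗-congʳ A (⊗-congˡ A′ BB′≐I) ⟩
  A ⊗ (idMat ⊗ A′)     ≈⟨ ⊗-congʳ A (⊗-identityˡ A′) ⟩
  A ⊗ A′               ≈⟨ AA′≐I ⟩
  idMat                ∎
  where open ≐-Reasoning

Unimodular-⊗ : ∀ {n} (P Q : Mat n) → Unimodular P → Unimodular Q → Unimodular (P ⊗ Q)
Unimodular-⊗ P Q (P′ , PP′≐I , P′P≐I) (Q′ , QQ′≐I , Q′Q≐I) =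
  Q′ ⊗ P′ , ⊗-inverse P P′ Q Q′ PP′≐I QQ′≐I , ⊗-inverse Q′ Q P′ P Q′Q≐I P′P≐I

record _∼_ {n} (A B : Mat n) : Set where
  constructor equivalent
  field
    P Q          : Mat n
    P-unimodular : Unimodular P
    Q-unimodular : Unimodular Q
    PAQ≐B        : (P ⊗ A) ⊗ Q ≐ B

Σ⇒∼ : ∀ {n} {A B : Mat n} → ∃[ P ] ∃[ Q ] (Unimodular P × Unimodular Q × (P ⊗ A) ⊗ Q ≐ B) → A ∼ B
Σ⇒∼ (P , Q , P-uni , Q-uni , PAQ≐B) = equivalent P Q P-uni Q-uni PAQ≐B

∼⇒Σ : ∀ {n} {A B : Mat n} → A ∼ B → ∃[ P ] ∃[ Q ] (Unimodular P × Unimodular Q × (P ⊗ A) ⊗ Q ≐ B)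
∼⇒Σ (equivalent P Q P-uni Q-uni PAQ≐B) = P , Q , P-uni , Q-uni , PAQ≐B

∼-reflexive : ∀ {n} {A B : Mat n} → A ≐ B → A ∼ B
∼-reflexive {A = A} A≐B = equivalent idMat idMat Unimodular-idMat Unimodular-idMat
  (≐-trans (⊗-identityʳ (idMat ⊗ A)) (≐-trans (⊗-identityˡ A) A≐B))

∼-trans : ∀ {n} {A B C : Mat n} → A ∼ B → B ∼ C → A ∼ C
∼-trans {A = A} {B} {C} (equivalent P Q P-uni Q-uni PAQ≐B) (equivalent R S R-uni S-uni RBS≐C) =
  equivalent (R ⊗ P) (Q ⊗ S) (Unimodular-⊗ R P R-uni P-uni) (Unimodular-⊗ Q S Q-uni S-uni) (begin
    ((R ⊗ P) ⊗ A) ⊗ (Q ⊗ S)  ≈⟨ ≐-sym (⊗-assoc ((R ⊗ P) ⊗ A) Q S) ⟩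
    (((R ⊗ P) ⊗ A) ⊗ Q) ⊗ S  ≈⟨ ⊗-congˡ S (⊗-congˡ Q (⊗-assoc R P A)) ⟩
    ((R ⊗ (P ⊗ A)) ⊗ Q) ⊗ S  ≈⟨ ⊗-congˡ S (⊗-assoc R (P ⊗ A) Q) ⟩
    (R ⊗ ((P ⊗ A) ⊗ Q)) ⊗ S  ≈⟨ ⊗-congˡ S (⊗-congʳ R PAQ≐B) ⟩
    (R ⊗ B) ⊗ S              ≈⟨ RBS≐C ⟩
    C                        ∎)
  where open ≐-Reasoning

∼-sym : ∀ {n} {A B : Mat n} → A ∼ B → B ∼ A
∼-sym {A = A} {B} (equivalent P Q (P′ , PP′≐I , P′P≐I) (Q′ , QQ′≐I , Q′Q≐I) PAQ≐B) =
  equivalent P′ Q′ (P , P′P≐I , PP′≐I) (Q , Q′Q≐I , QQ′≐I) (begin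
    (P′ ⊗ B) ⊗ Q′                   ≈⟨ ⊗-congˡ Q′ (⊗-congʳ P′ (≐-sym PAQ≐B)) ⟩
    (P′ ⊗ ((P ⊗ A) ⊗ Q)) ⊗ Q′       ≈⟨ ⊗-congˡ Q′ (≐-sym (⊗-assoc P′ (P ⊗ A) Q)) ⟩
    ((P′ ⊗ (P ⊗ A)) ⊗ Q) ⊗ Q′       ≈⟨ ⊗-assoc (P′ ⊗ (P ⊗ A)) Q Q′ ⟩
    (P′ ⊗ (P ⊗ A)) ⊗ (Q ⊗ Q′)       ≈⟨ ⊗-cong (≐-sym (⊗-assoc P′ P A)) QQ′≐I ⟩
    ((P′ ⊗ P) ⊗ A) ⊗ idMat          ≈⟨ ⊗-identityʳ ((P′ ⊗ P) ⊗ A) ⟩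
    (P′ ⊗ P) ⊗ A                    ≈⟨ ⊗-congˡ A P′P≐I ⟩
    idMat ⊗ A                       ≈⟨ ⊗-identityˡ A ⟩
    A                               ∎)
  where open ≐-Reasoning

infixl 30 _ᵀ

_ᵀ : ∀ {n} → Mat n → Mat n
(A ᵀ) i j = A j i

ᵀ-⊗ : ∀ {n} (A B : Mat n) → (A ⊗ B) ᵀ ≐ B ᵀ ⊗ A ᵀ
ᵀ-⊗ A B i j = sumℤ-cong (λ k → *-comm (A j k) (B k i))

idMatᵀ : ∀ {n} → idMat {n} ᵀ ≐ idMat
idMatᵀ i j = trans (idMat-δ j i) (trans (δ-sym j i) (sym (idMat-δ i j)))

ᵀ-inverse : ∀ {n} (P P′ : Mat n) → P ⊗ P′ ≐ idMat → P′ ᵀ ⊗ P ᵀ ≐ idMat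
ᵀ-inverse P P′ PP′≐I i j = trans (sym (ᵀ-⊗ P P′ i j)) (trans (PP′≐I j i) (idMatᵀ i j))

Unimodular-ᵀ : ∀ {n} (P : Mat n) → Unimodular P → Unimodular (P ᵀ)
Unimodular-ᵀ P (P′ , PP′≐I , P′P≐I) = P′ ᵀ , ᵀ-inverse P′ P P′P≐I , ᵀ-inverse P P′ PP′≐I

border : ∀ {n} → ℤ → Mat n → Mat (suc n)
border a A zero    zero    = a
border a A zero    (suc j) = + 0
border a A (suc i) zero    = + 0
border a A (suc i) (suc j) = A i j

borderᵀ : ∀ {n} a (A : Mat n) → border a A ᵀ ≐ border a (A ᵀ)
borderᵀ a A zero    zero    = refl
borderᵀ a A zero    (suc j) = refl
borderᵀ a A (suc i) zero    = refl
borderᵀ a A (suc i) (suc j) = refl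

border-cong : ∀ {n} a {A B : Mat n} → A ≐ B → border a A ≐ border a B
border-cong a A≐B zero    zero    = refl
border-cong a A≐B zero    (suc j) = refl
border-cong a A≐B (suc i) zero    = refl
border-cong a A≐B (suc i) (suc j) = A≐B i j

border-⊗ : ∀ {n} a b (A B : Mat n) → border a A ⊗ border b B ≐ border (a * b) (A ⊗ B)
border-⊗ a b A B zero    zero    = trans (cong (_+_ (a * b)) (sumℤ-zero (λ k → + 0 * border b B (suc k) zero) (λ _ → refl))) (+-identityʳ (a * b))
border-⊗ a b A B zero    (suc j) = cong₂ _+_ (*-zeroʳ a) (sumℤ-zero (λ k → + 0 * B k j) (λ _ → refl))
border-⊗ a b A B (suc i) zero    = trans (+-identityˡ _) (sumℤ-zero (λ k → A i k * + 0) (λ k → *-zeroʳ (A i k)))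
border-⊗ a b A B (suc i) (suc j) = +-identityˡ _

border-idMat : ∀ {n} → border {n} (+ 1) idMat ≐ idMat
border-idMat zero    zero    = refl
border-idMat zero    (suc j) = refl
border-idMat (suc i) zero    = refl
border-idMat (suc i) (suc j) = trans (idMat-δ i j) (sym (idMat-δ (suc i) (suc j)))

border-inverse : ∀ {n} (P P′ : Mat n) → P ⊗ P′ ≐ idMat → border (+ 1) P ⊗ border (+ 1) P′ ≐ idMat
border-inverse P P′ PP′≐I = ≐-trans (border-⊗ (+ 1) (+ 1) P P′) (≐-trans (border-cong (+ 1) PP′≐I) border-idMat)

Unimodular-border : ∀ {n} (P : Mat n) → Unimodular P → Unimodular (border (+ 1) P)
Unimodular-border P (P′ , PP′≐I , P′P≐I) =
  border (+ 1) P′ , border-inverse P P′ PP′≐I , border-inverse P′ P P′P≐I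

∼-border : ∀ {n} {A B : Mat n} → A ∼ B → border (+ 0) A ∼ border (+ 0) B
∼-border {A = A} {B} (equivalent P Q P-uni Q-uni PAQ≐B) =
  equivalent (border (+ 1) P) (border (+ 1) Q) (Unimodular-border P P-uni) (Unimodular-border Q Q-uni) (begin
    (border (+ 1) P ⊗ border (+ 0) A) ⊗ border (+ 1) Q  ≈⟨ ⊗-congˡ (border (+ 1) Q) (border-⊗ (+ 1) (+ 0) P A) ⟩
    border (+ 0) (P ⊗ A) ⊗ border (+ 1) Q              ≈⟨ border-⊗ (+ 0) (+ 1) (P ⊗ A) Q ⟩
    border (+ 0) ((P ⊗ A) ⊗ Q)                         ≈⟨ border-cong (+ 0) PAQ≐B ⟩
    border (+ 0) B                                     ∎)
  where open ≐-Reasoning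

reindex : ∀ {N n} → (Fin N → Fin n) → Mat n → Mat N
reindex f M i j = M (f i) (f j)

permMat : ∀ {n} → Permutation′ n → Mat n
permMat π i j = δ (π ⟨$⟩ʳ i) j

permMat-⊗ : ∀ {n} (π : Permutation′ n) (A : Mat n) → permMat π ⊗ A ≐ λ i j → A (π ⟨$⟩ʳ i) j
permMat-⊗ π A i j = sumℤ-δˡ (π ⟨$⟩ʳ i) (λ k → A k j)

ᵥ⊗-permMatᵀ : ∀ {n} (π : Permutation′ n) (w : Fin n → ℤ) j → (w ᵥ⊗ permMat π ᵀ) j ≡ w (π ⟨$⟩ʳ j)
ᵥ⊗-permMatᵀ π w j = trans (sumℤ-cong (λ k → cong (w k *_) (δ-sym (π ⟨$⟩ʳ j) k))) (sumℤ-δʳ (π ⟨$⟩ʳ j) w)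

⊗-permMatᵀ : ∀ {n} (π : Permutation′ n) (A : Mat n) → A ⊗ permMat π ᵀ ≐ λ i j → A i (π ⟨$⟩ʳ j)
⊗-permMatᵀ π A i j = ᵥ⊗-permMatᵀ π (A i) j

Unimodular-permMat : ∀ {n} (π : Permutation′ n) → Unimodular (permMat π)
Unimodular-permMat π = permMat (Perm.flip π) , inverse π , inverse (Perm.flip π)
  where
  inverse : ∀ ρ → permMat ρ ⊗ permMat (Perm.flip ρ) ≐ idMat
  inverse ρ i j = begin
    (permMat ρ ⊗ permMat (Perm.flip ρ)) i j ≡⟨ permMat-⊗ ρ (permMat (Perm.flip ρ)) i j ⟩
    δ (ρ ⟨$⟩ˡ (ρ ⟨$⟩ʳ i)) j                 ≡⟨ cong (λ k → δ k j) (Perm.inverseˡ ρ) ⟩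
    δ i j                                   ≡⟨ sym (idMat-δ i j) ⟩
    idMat i j                               ∎
    where open ≡-Reasoning

permMat-conjugate : ∀ {n} (π : Permutation′ n) (A : Mat n) → (permMat π ⊗ A) ⊗ permMat π ᵀ ≐ reindex (π ⟨$⟩ʳ_) A
permMat-conjugate π A i j = trans (⊗-permMatᵀ π (permMat π ⊗ A) i j) (permMat-⊗ π A i (π ⟨$⟩ʳ j))

∼-permute : ∀ {n} (π : Permutation′ n) (A : Mat n) → A ∼ reindex (π ⟨$⟩ʳ_) A
∼-permute π A = equivalent (permMat π) (permMat π ᵀ) (Unimodular-permMat π) (Unimodular-ᵀ (permMat π) (Unimodular-permMat π)) (permMat-conjugate π A)

Unimodular-permute : ∀ {n} (π : Permutation′ n) (U : Mat n) → Unimodular U → Unimodular (reindex (π ⟨$⟩ʳ_) U)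
Unimodular-permute π U U-uni = Unimodular-resp-≐ ((permMat π ⊗ U) ⊗ permMat π ᵀ) (reindex (π ⟨$⟩ʳ_) U) (permMat-conjugate π U)
  (Unimodular-⊗ (permMat π ⊗ U) (permMat π ᵀ) (Unimodular-⊗ (permMat π) U (Unimodular-permMat π) U-uni)
                (Unimodular-ᵀ (permMat π) (Unimodular-permMat π)))

x+y*[z*0]≡x : ∀ x y z → x + y * (z * + 0) ≡ x
x+y*[z*0]≡x = solve-∀

x*[y*z]≡z*[y*x] : ∀ x y z → x * (y * z) ≡ z * (y * x)
x*[y*z]≡z*[y*x] = solve-∀

transvection : ∀ {n} → Fin n → Fin n → ℤ → Mat n
transvection a b c i j = δ i j + δ i a * (c * δ b j)

ᵥ⊗-transvection : ∀ {n} (w : Fin n → ℤ) (a b : Fin n) c j →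
  (w ᵥ⊗ transvection a b c) j ≡ w j + w a * (c * δ b j)
ᵥ⊗-transvection w a b c j = begin
  sumℤ (λ i → w i * (δ i j + δ i a * (c * δ b j)))
    ≡⟨ sumℤ-cong (λ i → *-distribˡ-+ (w i) (δ i j) _) ⟩
  sumℤ (λ i → w i * δ i j + w i * (δ i a * (c * δ b j)))
    ≡⟨ sumℤ-distrib-+ (λ i → w i * δ i j) (λ i → w i * (δ i a * (c * δ b j))) ⟩
  sumℤ (λ i → w i * δ i j) + sumℤ (λ i → w i * (δ i a * (c * δ b j)))
    ≡⟨ cong₂ _+_ (sumℤ-δʳ j w) (sumℤ-cong (λ i → sym (*-assoc (w i) (δ i a) (c * δ b j)))) ⟩
  w j + sumℤ (λ i → w i * δ i a * (c * δ b j))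
    ≡⟨ cong (_+_ (w j)) (sym (*-distribʳ-sumℤ (c * δ b j) (λ i → w i * δ i a))) ⟩
  w j + sumℤ (λ i → w i * δ i a) * (c * δ b j)
    ≡⟨ cong (λ x → w j + x * (c * δ b j)) (sumℤ-δʳ a w) ⟩
  w j + w a * (c * δ b j) ∎
  where open ≡-Reasoning

transvectionᵀ : ∀ {n} (a b : Fin n) c → transvection a b c ᵀ ≐ transvection b a c
transvectionᵀ a b c i j = cong₂ _+_ (δ-sym j i) (begin
  δ j a * (c * δ b i) ≡⟨ cong₂ (λ x y → x * (c * y)) (δ-sym j a) (δ-sym b i) ⟩
  δ a j * (c * δ i b) ≡⟨ x*[y*z]≡z*[y*x] (δ a j) c (δ i b) ⟩
  δ i b * (c * δ a j) ∎)
  where open ≡-Reasoning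

transvection-⊗ : ∀ {n} (a b : Fin n) c (B : Mat n) i j →
  (transvection a b c ⊗ B) i j ≡ B i j + δ i a * (c * B b j)
transvection-⊗ a b c B i j = begin
  (transvection a b c ⊗ B) i j                 ≡⟨ ᵀ-⊗ (transvection a b c) B j i ⟩
  (B ᵀ ⊗ transvection a b c ᵀ) j i             ≡⟨ ⊗-congʳ (B ᵀ) (transvectionᵀ a b c) j i ⟩
  (B ᵀ ⊗ transvection b a c) j i               ≡⟨ ᵥ⊗-transvection ((B ᵀ) j) b a c i ⟩
  B i j + B b j * (c * δ a i)                  ≡⟨ cong (_+_ (B i j)) (x*[y*z]≡z*[y*x] (B b j) c (δ a i)) ⟩
  B i j + δ a i * (c * B b j)                  ≡⟨ cong (λ x → B i j + x * (c * B b j)) (δ-sym a i) ⟩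
  B i j + δ i a * (c * B b j)                  ∎
  where open ≡-Reasoning

transvection-inverse : ∀ {n} {a b : Fin n} → a ≢ b → ∀ c c′ → c + c′ ≡ + 0 →
  transvection a b c ⊗ transvection a b c′ ≐ idMat
transvection-inverse {a = a} {b} a≢b c c′ c+c′≡0 i j = begin
  (transvection a b c ⊗ transvection a b c′) i j
    ≡⟨ ᵥ⊗-transvection (transvection a b c i) a b c′ j ⟩
  δ i j + δ i a * (c * δ b j) + (δ i a + δ i a * (c * δ b a)) * (c′ * δ b j)
    ≡⟨ cong (λ x → δ i j + δ i a * (c * δ b j) + (δ i a + δ i a * (c * x)) * (c′ * δ b j)) (δ-≢ (a≢b ∘′ sym)) ⟩
  δ i j + δ i a * (c * δ b j) + (δ i a + δ i a * (c * + 0)) * (c′ * δ b j)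
    ≡⟨ collect (δ i j) (δ i a) (δ b j) c c′ ⟩
  δ i j + δ i a * δ b j * (c + c′)
    ≡⟨ cong (λ x → δ i j + δ i a * δ b j * x) c+c′≡0 ⟩
  δ i j + δ i a * δ b j * + 0
    ≡⟨ trans (cong (_+_ (δ i j)) (*-zeroʳ (δ i a * δ b j))) (+-identityʳ (δ i j)) ⟩
  δ i j
    ≡⟨ sym (idMat-δ i j) ⟩
  idMat i j ∎
  where
  open ≡-Reasoning
  collect : ∀ x y z c c′ → x + y * (c * z) + (y + y * (c * + 0)) * (c′ * z) ≡ x + y * z * (c + c′)
  collect = solve-∀

Unimodular-transvection : ∀ {n} (a b : Fin n) c → a ≢ b → Unimodular (transvection a b c)
Unimodular-transvection a b c a≢b =
  transvection a b (- c) , transvection-inverse a≢b c (- c) (+-inverseʳ c) , transvection-inverse a≢b (- c) c (+-inverseˡ c)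

-- Completing a primitive vector to a unimodular matrix

swap₀₁ : ∀ {K} → Permutation′ (suc (suc K))
swap₀₁ = Perm.transpose zero (suc zero)

record SecondClearing {K} (w : Fin (suc (suc K)) → ℤ) : Set where
  field
    U            : Mat (suc (suc K))
    unimodular   : Unimodular U
    cleared      : (w ᵥ⊗ U) (suc zero) ≡ + 0
    fixes-second : w (suc zero) ≡ + 0 → ∀ i → U i (suc zero) ≡ δ i (suc zero)
    fixes-rest   : ∀ i j → U i (suc (suc j)) ≡ δ i (suc (suc j))

identityClearing : ∀ {K} (w : Fin (suc (suc K)) → ℤ) → w (suc zero) ≡ + 0 → SecondClearing w
identityClearing w w₁≡0 = record
  { U            = idMat
  ; unimodular   = Unimodular-idMat
  ; cleared      = trans (ᵥ⊗-idMat w (suc zero)) w₁≡0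
  ; fixes-second = λ _ i → idMat-δ i (suc zero)
  ; fixes-rest   = λ i j → idMat-δ i (suc (suc j))
  }

-- One step of the Euclidean algorithm on (w₀, w₁): replace w₀ by its remainder modulo w₁, then swap.
euclidStep : ∀ {K} (w : Fin (suc (suc K)) → ℤ) .{{_ : NonZero (w (suc zero))}} →
  (∀ w′ → ∣ w′ (suc zero) ∣ ℕ.< ∣ w (suc zero) ∣ → SecondClearing w′) → SecondClearing w
euclidStep {K} w recurse = record
  { U            = U
  ; unimodular   = Unimodular-⊗ (T ⊗ S) V
                     (Unimodular-⊗ T S (Unimodular-transvection (suc zero) zero (- q) (λ ()))
                                       (Unimodular-ᵀ (permMat swap₀₁) (Unimodular-permMat swap₀₁)))
                     (SecondClearing.unimodular next)
  ; cleared      = trans (ᵥ⊗-assoc w (T ⊗ S) V (suc zero))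
                     (trans (ᵥ⊗-congˡ V (ᵥ⊗-assoc w T S) (suc zero)) (SecondClearing.cleared next))
  ; fixes-second = λ w₁≡0 → ⊥-elim (ℕ.≢-nonZero⁻¹ ∣ w (suc zero) ∣ (cong ∣_∣ w₁≡0))
  ; fixes-rest   = fixes-rest
  }
  where
  q : ℤ
  q = w zero / w (suc zero)
  T S : Mat (suc (suc K))
  T = transvection (suc zero) zero (- q)
  S = permMat swap₀₁ ᵀ
  wT≡r : (w ᵥ⊗ T) zero ≡ + (w zero % w (suc zero))
  wT≡r = begin
    (w ᵥ⊗ T) zero                                   ≡⟨ ᵥ⊗-transvection w (suc zero) zero (- q) zero ⟩
    w zero + w (suc zero) * (- q * + 1)             ≡⟨ cong (λ x → x + w (suc zero) * (- q * + 1)) (a≡a%n+[a/n]*n (w zero) (w (suc zero))) ⟩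
    + (w zero % w (suc zero)) + q * w (suc zero) + w (suc zero) * (- q * + 1)
                                                    ≡⟨ cancel (+ (w zero % w (suc zero))) q (w (suc zero)) ⟩
    + (w zero % w (suc zero))                       ∎
    where
    open ≡-Reasoning
    cancel : ∀ r q b → r + q * b + b * (- q * + 1) ≡ r
    cancel = solve-∀
  next : SecondClearing ((w ᵥ⊗ T) ᵥ⊗ S)
  next = recurse ((w ᵥ⊗ T) ᵥ⊗ S)
    (subst (λ x → ∣ x ∣ ℕ.< ∣ w (suc zero) ∣) (sym (trans (ᵥ⊗-permMatᵀ swap₀₁ (w ᵥ⊗ T) (suc zero)) wT≡r))
      (n%d<d (w zero) (w (suc zero))))
  V U : Mat (suc (suc K))
  V = SecondClearing.U next
  U = (T ⊗ S) ⊗ V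
  fixes-rest : ∀ i j → U i (suc (suc j)) ≡ δ i (suc (suc j))
  fixes-rest i j = begin
    U i (suc (suc j))                               ≡⟨ ᵥ⊗-unit-column ((T ⊗ S) i) V (suc (suc j)) (λ k → SecondClearing.fixes-rest next k j) ⟩
    (T ⊗ S) i (suc (suc j))                         ≡⟨ ⊗-permMatᵀ swap₀₁ T i (suc (suc j)) ⟩
    δ i (suc (suc j)) + δ i (suc zero) * (- q * + 0) ≡⟨ x+y*[z*0]≡x (δ i (suc (suc j))) (δ i (suc zero)) (- q) ⟩
    δ i (suc (suc j))                               ∎
    where open ≡-Reasoning

clearSecondWithin : ∀ {K} fuel (w : Fin (suc (suc K)) → ℤ) → ∣ w (suc zero) ∣ ℕ.< fuel → SecondClearing w
clearSecondWithin (suc fuel) w bound with w (suc zero) ≟ + 0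
... | yes w₁≡0 = identityClearing w w₁≡0
... | no  w₁≢0 = euclidStep w {{≢-nonZero w₁≢0}}
                   (λ w′ smaller → clearSecondWithin fuel w′ (ℕ.≤-trans smaller (ℕ.≤-pred bound)))

clearSecond : ∀ {K} (w : Fin (suc (suc K)) → ℤ) → SecondClearing w
clearSecond w = clearSecondWithin (suc ∣ w (suc zero) ∣) w ℕ.≤-refl

insertUnit₁ : ∀ {K} → Mat (suc K) → Mat (suc (suc K))
insertUnit₁ V = reindex (swap₀₁ ⟨$⟩ʳ_) (border (+ 1) V)

insertUnit₁-second-column : ∀ {K} (V : Mat (suc K)) i → insertUnit₁ V i (suc zero) ≡ δ i (suc zero)
insertUnit₁-second-column V zero          = refl
insertUnit₁-second-column V (suc zero)    = refl
insertUnit₁-second-column V (suc (suc i)) = refl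

insertUnit₁-unit-column : ∀ {K} (V : Mat (suc K)) k → (∀ i → V i (suc k) ≡ δ i (suc k)) →
  ∀ i → insertUnit₁ V i (suc (suc k)) ≡ δ i (suc (suc k))
insertUnit₁-unit-column V k column≗δ zero          = column≗δ zero
insertUnit₁-unit-column V k column≗δ (suc zero)    = refl
insertUnit₁-unit-column V k column≗δ (suc (suc i)) = column≗δ (suc i)

insertUnit₁-punchIn : ∀ {K} (V : Mat (suc K)) i j →
  insertUnit₁ V (punchIn (suc zero) i) (punchIn (suc zero) j) ≡ V i j
insertUnit₁-punchIn V zero    zero    = refl
insertUnit₁-punchIn V zero    (suc j) = refl
insertUnit₁-punchIn V (suc i) zero    = refl
insertUnit₁-punchIn V (suc i) (suc j) = refl

ᵥ⊗-insertUnit₁ : ∀ {K} (w : Fin (suc (suc K)) → ℤ) (V : Mat (suc K)) → w (suc zero) ≡ + 0 →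
  ∀ j → (w ᵥ⊗ insertUnit₁ V) (punchIn (suc zero) j) ≡ (removeAt w (suc zero) ᵥ⊗ V) j
ᵥ⊗-insertUnit₁ w V w₁≡0 j = begin
  (w ᵥ⊗ insertUnit₁ V) (punchIn (suc zero) j)
    ≡⟨ sumℤ-remove (suc zero) (λ i → w i * insertUnit₁ V i (punchIn (suc zero) j)) ⟩
  w (suc zero) * insertUnit₁ V (suc zero) (punchIn (suc zero) j)
    + sumℤ (λ i → w (punchIn (suc zero) i) * insertUnit₁ V (punchIn (suc zero) i) (punchIn (suc zero) j))
    ≡⟨ cong₂ (λ x y → x * insertUnit₁ V (suc zero) (punchIn (suc zero) j) + y) w₁≡0
         (sumℤ-cong (λ i → cong (w (punchIn (suc zero) i) *_) (insertUnit₁-punchIn V i j))) ⟩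
  + 0 * insertUnit₁ V (suc zero) (punchIn (suc zero) j) + (removeAt w (suc zero) ᵥ⊗ V) j
    ≡⟨ +-identityˡ _ ⟩
  (removeAt w (suc zero) ᵥ⊗ V) j ∎
  where open ≡-Reasoning

record Completion {K} (w : Fin (suc K) → ℤ) : Set where
  field
    U            : Mat (suc K)
    unimodular   : Unimodular U
    sends-to-e₀  : ∀ j → (w ᵥ⊗ U) j ≡ δ zero j
    fixes-zeros  : ∀ i j → w (suc j) ≡ + 0 → U i (suc j) ≡ δ i (suc j)

  U⁻¹ : Mat (suc K)
  U⁻¹ = proj₁ unimodular

  U⁻¹-first-row : ∀ j → U⁻¹ zero j ≡ w j
  U⁻¹-first-row j = begin
    U⁻¹ zero j                    ≡⟨ sumℤ-δˡ zero (λ k → U⁻¹ k j) ⟨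
    ((λ k → δ zero k) ᵥ⊗ U⁻¹) j   ≡⟨ ᵥ⊗-congˡ U⁻¹ (λ k → sym (sends-to-e₀ k)) j ⟩
    ((w ᵥ⊗ U) ᵥ⊗ U⁻¹) j           ≡⟨ ᵥ⊗-assoc w U U⁻¹ j ⟨
    (w ᵥ⊗ (U ⊗ U⁻¹)) j            ≡⟨ sumℤ-cong (λ k → cong (w k *_) (proj₁ (proj₂ unimodular) k j)) ⟩
    (w ᵥ⊗ idMat) j                ≡⟨ ᵥ⊗-idMat w j ⟩
    w j                           ∎
    where open ≡-Reasoning

  U⁻¹-fixes-zeros : ∀ i j → w (suc j) ≡ + 0 → U⁻¹ i (suc j) ≡ δ i (suc j)
  U⁻¹-fixes-zeros i j wⱼ≡0 = begin
    U⁻¹ i (suc j)           ≡⟨ ᵥ⊗-unit-column (U⁻¹ i) U (suc j) (λ k → fixes-zeros k j wⱼ≡0) ⟨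
    (U⁻¹ ⊗ U) i (suc j)     ≡⟨ proj₂ (proj₂ unimodular) i (suc j) ⟩
    idMat i (suc j)         ≡⟨ idMat-δ i (suc j) ⟩
    δ i (suc j)             ∎
    where open ≡-Reasoning

complete : ∀ {K} (w z : Fin (suc K) → ℤ) → ⟨ w , z ⟩ ≡ + 1 → Completion w
complete {zero} w z w·z≡1 = record
  { U           = λ _ _ → z zero
  ; unimodular  = (λ _ _ → w zero) , (λ { zero zero → trans (⟨⟩-comm z w) w·z≡1 }) , (λ { zero zero → w·z≡1 })
  ; sends-to-e₀ = λ { zero → w·z≡1 }
  ; fixes-zeros = λ _ ()
  }
complete {suc K} w z w·z≡1 = record
  { U           = U₁ ⊗ E
  ; unimodular  = Unimodular-⊗ U₁ E (SecondClearing.unimodular C)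
                    (Unimodular-permute swap₀₁ (border (+ 1) U₂) (Unimodular-border U₂ (Completion.unimodular R)))
  ; sends-to-e₀ = λ j → trans (ᵥ⊗-assoc w U₁ E j) (sends-to-e₀ j)
  ; fixes-zeros = fixes-zeros
  }
  where
  C : SecondClearing w
  C = clearSecond w
  U₁ U₁′ : Mat (suc (suc K))
  U₁ = SecondClearing.U C
  U₁′ = proj₁ (SecondClearing.unimodular C)
  w′ z′ : Fin (suc (suc K)) → ℤ
  w′ = w ᵥ⊗ U₁
  z′ = U₁′ ⊗ᵥ z
  w′·z′≡1 : ⟨ removeAt w′ (suc zero) , removeAt z′ (suc zero) ⟩ ≡ + 1
  w′·z′≡1 = begin
    ⟨ removeAt w′ (suc zero) , removeAt z′ (suc zero) ⟩  ≡⟨ ⟨⟩-removeAt (suc zero) w′ z′ (SecondClearing.cleared C) ⟨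
    ⟨ w′ , z′ ⟩                                          ≡⟨ ⟨⟩-unimodular w z U₁ U₁′ (proj₁ (proj₂ (SecondClearing.unimodular C))) ⟩
    ⟨ w , z ⟩                                            ≡⟨ w·z≡1 ⟩
    + 1                                                  ∎
    where open ≡-Reasoning
  R : Completion (removeAt w′ (suc zero))
  R = complete (removeAt w′ (suc zero)) (removeAt z′ (suc zero)) w′·z′≡1
  U₂ : Mat (suc K)
  U₂ = Completion.U R
  E : Mat (suc (suc K))
  E = insertUnit₁ U₂
  sends-to-e₀ : ∀ j → (w′ ᵥ⊗ E) j ≡ δ zero j
  sends-to-e₀ zero          = trans (ᵥ⊗-insertUnit₁ w′ U₂ (SecondClearing.cleared C) zero) (Completion.sends-to-e₀ R zero)
  sends-to-e₀ (suc zero)    = trans (ᵥ⊗-unit-column w′ E (suc zero) (insertUnit₁-second-column U₂)) (SecondClearing.cleared C)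
  sends-to-e₀ (suc (suc j)) = trans (ᵥ⊗-insertUnit₁ w′ U₂ (SecondClearing.cleared C) (suc j)) (Completion.sends-to-e₀ R (suc j))
  fixes-zeros : ∀ i j → w (suc j) ≡ + 0 → (U₁ ⊗ E) i (suc j) ≡ δ i (suc j)
  fixes-zeros i zero    w₁≡0 =
    trans (ᵥ⊗-unit-column (U₁ i) E (suc zero) (insertUnit₁-second-column U₂)) (SecondClearing.fixes-second C w₁≡0 i)
  fixes-zeros i (suc j) wⱼ≡0 =
    trans (ᵥ⊗-unit-column (U₁ i) E (suc (suc j)) (insertUnit₁-unit-column U₂ j (λ k → Completion.fixes-zeros R k j w′ⱼ≡0)))
          (SecondClearing.fixes-rest C i j)
    where
    w′ⱼ≡0 : w′ (suc (suc j)) ≡ + 0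
    w′ⱼ≡0 = trans (ᵥ⊗-unit-column w U₁ (suc (suc j)) (λ k → SecondClearing.fixes-rest C k j)) wⱼ≡0

-- Cancelling a zero border against a diagonal matrix

i*j≡0⇒i≡0 : ∀ i {j} → j ≢ + 0 → i * j ≡ + 0 → i ≡ + 0
i*j≡0⇒i≡0 i j≢0 ij≡0 = [ id , ⊥-elim ∘′ j≢0 ]′ (i*j≡0⇒i≡0∨j≡0 i ij≡0)

diag : ∀ {n} → (Fin n → ℤ) → Mat n
diag e i j = δ i j * e j

⊗-diag : ∀ {n} (A : Mat n) (e : Fin n → ℤ) i j → (A ⊗ diag e) i j ≡ A i j * e j
⊗-diag A e i j = trans (sumℤ-cong (λ k → sym (*-assoc (A i k) (δ k j) (e j))))
                       (trans (sym (*-distribʳ-sumℤ (e j) (λ k → A i k * δ k j))) (cong (_* e j) (sumℤ-δʳ j (A i))))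

diagᵀ : ∀ {n} (e : Fin n → ℤ) → diag e ᵀ ≐ diag e
diagᵀ e i j = trans (cong (_* e i) (δ-sym j i)) (δ-*-swap e i j)

diag-cong : ∀ {n} {e e′ : Fin n → ℤ} → (∀ i → e i ≡ e′ i) → diag e ≐ diag e′
diag-cong e≗e′ i j = cong (δ i j *_) (e≗e′ j)

⊗-diag-fixed : ∀ {n} (T : Mat n) (e : Fin n → ℤ) → (∀ j → e j ≢ + 0 → ∀ i → T i j ≡ δ i j) → T ⊗ diag e ≐ diag e
⊗-diag-fixed T e fixed i j with e j ≟ + 0
... | yes eⱼ≡0 = trans (⊗-diag T e i j) (trans (cong (T i j *_) eⱼ≡0) (trans (*-zeroʳ (T i j)) (sym (trans (cong (δ i j *_) eⱼ≡0) (*-zeroʳ (δ i j))))))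
... | no  eⱼ≢0 = trans (⊗-diag T e i j) (cong (_* e j) (fixed j eⱼ≢0 i))

first-row-annihilates : ∀ {m} (A : Mat m) (P P′ Q : Mat (suc m)) (e : Fin (suc m) → ℤ) → P′ ⊗ P ≐ idMat →
  (P ⊗ border (+ 0) A) ⊗ Q ≐ diag e → ∀ j → P′ zero j * e j ≡ + 0
first-row-annihilates {m} A P P′ Q e P′P≐I PXQ≐D j = begin
  P′ zero j * e j                          ≡⟨ ⊗-diag P′ e zero j ⟨
  (P′ ⊗ diag e) zero j                     ≡⟨ ⊗-congʳ P′ (≐-sym PXQ≐D) zero j ⟩
  (P′ ⊗ ((P ⊗ X) ⊗ Q)) zero j              ≡⟨ ⊗-congʳ P′ (⊗-assoc P X Q) zero j ⟩
  (P′ ⊗ (P ⊗ (X ⊗ Q))) zero j              ≡⟨ ⊗-assoc P′ P (X ⊗ Q) zero j ⟨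
  ((P′ ⊗ P) ⊗ (X ⊗ Q)) zero j              ≡⟨ ⊗-congˡ (X ⊗ Q) P′P≐I zero j ⟩
  (idMat ⊗ (X ⊗ Q)) zero j                 ≡⟨ ⊗-identityˡ (X ⊗ Q) zero j ⟩
  (X ⊗ Q) zero j                           ≡⟨ sumℤ-zero (λ k → X zero k * Q k j) (λ { zero → refl ; (suc k) → refl }) ⟩
  + 0                                      ∎
  where
  open ≡-Reasoning
  X : Mat (suc m)
  X = border (+ 0) A

record FirstRowNormalized {m} (A : Mat m) (Q : Mat (suc m)) (e : Fin (suc m) → ℤ) : Set where
  field
    P          : Mat (suc m)
    unimodular : Unimodular P
    first-row  : ∀ j → P zero j ≡ δ zero j
    equation   : (P ⊗ border (+ 0) A) ⊗ Q ≐ diag e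

-- The first row w of P⁻¹ is primitive and vanishes wherever e does not; completing it gives T.
normalizeFirstRow : ∀ {m} (A : Mat m) (P Q : Mat (suc m)) (e : Fin (suc m) → ℤ) → e zero ≡ + 0 → Unimodular P →
  (P ⊗ border (+ 0) A) ⊗ Q ≐ diag e → FirstRowNormalized A Q e
normalizeFirstRow {m} A P Q e e₀≡0 P-uni@(P′ , PP′≐I , P′P≐I) PXQ≐D = record
  { P          = T ⊗ P
  ; unimodular = Unimodular-⊗ T P (Unimodular-inverse (Completion.U C) (Completion.unimodular C)) P-uni
  ; first-row  = TP-first-row
  ; equation   = TPXQ≐D
  }
  where
  X : Mat (suc m)
  X = border (+ 0) A
  w : Fin (suc m) → ℤ
  w = P′ zero
  C : Completion w
  C = complete w (λ k → P k zero) (P′P≐I zero zero)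
  T : Mat (suc m)
  T = Completion.U⁻¹ C
  TP-first-row : ∀ j → (T ⊗ P) zero j ≡ δ zero j
  TP-first-row j = trans (ᵥ⊗-congˡ P (Completion.U⁻¹-first-row C) j) (trans (P′P≐I zero j) (idMat-δ zero j))
  T-fixed : ∀ j → e j ≢ + 0 → ∀ i → T i j ≡ δ i j
  T-fixed zero    e₀≢0 i = ⊥-elim (e₀≢0 e₀≡0)
  T-fixed (suc j) eⱼ≢0 i = Completion.U⁻¹-fixes-zeros C i j
    (i*j≡0⇒i≡0 (w (suc j)) eⱼ≢0 (first-row-annihilates A P P′ Q e P′P≐I PXQ≐D (suc j)))
  TPXQ≐D : ((T ⊗ P) ⊗ X) ⊗ Q ≐ diag e
  TPXQ≐D = begin
    ((T ⊗ P) ⊗ X) ⊗ Q  ≈⟨ ⊗-congˡ Q (⊗-assoc T P X) ⟩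
    (T ⊗ (P ⊗ X)) ⊗ Q  ≈⟨ ⊗-assoc T (P ⊗ X) Q ⟩
    T ⊗ ((P ⊗ X) ⊗ Q)  ≈⟨ ⊗-congʳ T PXQ≐D ⟩
    T ⊗ diag e         ≈⟨ ⊗-diag-fixed T e T-fixed ⟩
    diag e             ∎
    where open ≐-Reasoning

lowerRight : ∀ {m} → Mat (suc m) → Mat m
lowerRight A i j = A (suc i) (suc j)

lowerRight-inverse : ∀ {m} (P P′ : Mat (suc m)) → P ⊗ P′ ≐ idMat → (∀ j → P′ zero (suc j) ≡ + 0) →
  lowerRight P ⊗ lowerRight P′ ≐ idMat
lowerRight-inverse P P′ PP′≐I P′₀≡0 i j = begin
  (lowerRight P ⊗ lowerRight P′) i j                      ≡⟨ +-identityˡ _ ⟨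
  + 0 + (lowerRight P ⊗ lowerRight P′) i j                ≡⟨ cong (_+ (lowerRight P ⊗ lowerRight P′) i j)
                                                              (trans (sym (*-zeroʳ (P (suc i) zero))) (cong (P (suc i) zero *_) (sym (P′₀≡0 j)))) ⟩
  (P ⊗ P′) (suc i) (suc j)                                ≡⟨ PP′≐I (suc i) (suc j) ⟩
  idMat (suc i) (suc j)                                   ≡⟨ trans (idMat-δ (suc i) (suc j)) (sym (idMat-δ i j)) ⟩
  idMat i j                                               ∎
  where open ≡-Reasoning

Unimodular-lowerRight : ∀ {m} (P : Mat (suc m)) → Unimodular P → (∀ j → P zero j ≡ δ zero j) → Unimodular (lowerRight P)
Unimodular-lowerRight P (P′ , PP′≐I , P′P≐I) P₀≡δ =
  lowerRight P′ , lowerRight-inverse P P′ PP′≐I P′₀≡0 , lowerRight-inverse P′ P P′P≐I (λ j → P₀≡δ (suc j))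
  where
  P′₀≡0 : ∀ j → P′ zero (suc j) ≡ + 0
  P′₀≡0 j = begin
    P′ zero (suc j)                         ≡⟨ sumℤ-δˡ zero (λ k → P′ k (suc j)) ⟨
    sumℤ (λ k → δ zero k * P′ k (suc j))    ≡⟨ sumℤ-cong (λ k → cong (_* P′ k (suc j)) (sym (P₀≡δ k))) ⟩
    (P ⊗ P′) zero (suc j)                   ≡⟨ trans (PP′≐I zero (suc j)) (idMat-δ zero (suc j)) ⟩
    + 0                                     ∎
    where open ≡-Reasoning

⊗-border₀-zero : ∀ {m} (P : Mat (suc m)) (A : Mat m) i → (P ⊗ border (+ 0) A) i zero ≡ + 0
⊗-border₀-zero P A i = sumℤ-zero (λ k → P i k * border (+ 0) A k zero)
  (λ { zero → *-zeroʳ (P i zero) ; (suc k) → *-zeroʳ (P i (suc k)) })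

⊗-border₀-suc : ∀ {m} (P : Mat (suc m)) (A : Mat m) i j → (P ⊗ border (+ 0) A) i (suc j) ≡ ((λ k → P i (suc k)) ᵥ⊗ A) j
⊗-border₀-suc P A i j = trans (cong (_+ ((λ k → P i (suc k)) ᵥ⊗ A) j) (*-zeroʳ (P i zero))) (+-identityˡ _)

lowerRight-border₀ : ∀ {m} (P Q : Mat (suc m)) (A : Mat m) →
  lowerRight ((P ⊗ border (+ 0) A) ⊗ Q) ≐ (lowerRight P ⊗ A) ⊗ lowerRight Q
lowerRight-border₀ {m} P Q A i j = begin
  (P ⊗ X) (suc i) zero * Q zero (suc j) + sumℤ (λ k → (P ⊗ X) (suc i) (suc k) * Q (suc k) (suc j))
    ≡⟨ cong₂ _+_ (cong (_* Q zero (suc j)) (⊗-border₀-zero P A (suc i)))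
                 (sumℤ-cong (λ k → cong (_* Q (suc k) (suc j)) (⊗-border₀-suc P A (suc i) k))) ⟩
  + 0 * Q zero (suc j) + ((lowerRight P ⊗ A) ⊗ lowerRight Q) i j
    ≡⟨ +-identityˡ _ ⟩
  ((lowerRight P ⊗ A) ⊗ lowerRight Q) i j ∎
  where
  open ≡-Reasoning
  X : Mat (suc m)
  X = border (+ 0) A

ᵀ-⊗₃ : ∀ {n} (A B C : Mat n) → ((A ⊗ B) ⊗ C) ᵀ ≐ (C ᵀ ⊗ B ᵀ) ⊗ A ᵀ
ᵀ-⊗₃ A B C = ≐-trans (ᵀ-⊗ (A ⊗ B) C) (≐-trans (⊗-congʳ (C ᵀ) (ᵀ-⊗ A B)) (≐-sym (⊗-assoc (C ᵀ) (B ᵀ) (A ᵀ))))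

transpose-equation : ∀ {m} (A : Mat m) (P Q : Mat (suc m)) (e : Fin (suc m) → ℤ) →
  (P ⊗ border (+ 0) A) ⊗ Q ≐ diag e → (Q ᵀ ⊗ border (+ 0) (A ᵀ)) ⊗ P ᵀ ≐ diag e
transpose-equation A P Q e PXQ≐D = begin
  (Q ᵀ ⊗ border (+ 0) (A ᵀ)) ⊗ P ᵀ   ≈⟨ ⊗-congˡ (P ᵀ) (⊗-congʳ (Q ᵀ) (≐-sym (borderᵀ (+ 0) A))) ⟩
  (Q ᵀ ⊗ border (+ 0) A ᵀ) ⊗ P ᵀ     ≈⟨ ≐-sym (ᵀ-⊗₃ P (border (+ 0) A) Q) ⟩
  ((P ⊗ border (+ 0) A) ⊗ Q) ᵀ       ≈⟨ (λ i j → PXQ≐D j i) ⟩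
  diag e ᵀ                           ≈⟨ diagᵀ e ⟩
  diag e                             ∎
  where open ≐-Reasoning

-- Normalize the first row of P, then (after transposing) the first column of Q; the zero border then splits off.
cancel-border₀ : ∀ {m} (A : Mat m) (e : Fin m → ℤ) → border (+ 0) A ∼ diag (+ 0 ∷ᵥ e) → A ∼ diag e
cancel-border₀ {m} A e (equivalent P Q P-uni Q-uni PXQ≐D) =
  equivalent (lowerRight P₁) (lowerRight Q₁ ᵀ) (Unimodular-lowerRight P₁ P₁-uni P₁-row)
    (Unimodular-ᵀ (lowerRight Q₁) (Unimodular-lowerRight Q₁ Q₁-uni Q₁-row)) (begin
      (lowerRight P₁ ⊗ A) ⊗ lowerRight Q₁ ᵀ      ≈⟨ ≐-sym (lowerRight-border₀ P₁ (Q₁ ᵀ) A) ⟩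
      lowerRight ((P₁ ⊗ border (+ 0) A) ⊗ Q₁ ᵀ)  ≈⟨ (λ i j → P₁XQ₁ᵀ≐D (suc i) (suc j)) ⟩
      diag e                                     ∎)
  where
  open ≐-Reasoning
  e′ : Fin (suc m) → ℤ
  e′ = + 0 ∷ᵥ e
  rows : FirstRowNormalized A Q e′
  rows = normalizeFirstRow A P Q e′ refl P-uni PXQ≐D
  open FirstRowNormalized rows using () renaming (P to P₁; unimodular to P₁-uni; first-row to P₁-row; equation to P₁XQ≐D)
  columns : FirstRowNormalized (A ᵀ) (P₁ ᵀ) e′
  columns = normalizeFirstRow (A ᵀ) (Q ᵀ) (P₁ ᵀ) e′ refl (Unimodular-ᵀ Q Q-uni)
              (transpose-equation A P₁ Q e′ P₁XQ≐D)
  open FirstRowNormalized columns using () renaming (P to Q₁; unimodular to Q₁-uni; first-row to Q₁-row; equation to Q₁YP₁ᵀ≐D)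
  P₁XQ₁ᵀ≐D : (P₁ ⊗ border (+ 0) A) ⊗ Q₁ ᵀ ≐ diag e′
  P₁XQ₁ᵀ≐D = transpose-equation (A ᵀ) Q₁ (P₁ ᵀ) e′ Q₁YP₁ᵀ≐D

border₀-≁-invertible-diag : ∀ {m} (A : Mat m) (e : Fin (suc m) → ℤ) → (∀ j → e j ≢ + 0) → ¬ (border (+ 0) A ∼ diag e)
border₀-≁-invertible-diag A e e≢0 (equivalent P Q (P′ , _ , P′P≐I) _ PXQ≐D) = 0≢1 (begin
  + 0                                     ≡⟨ sumℤ-zero (λ k → P′ zero k * P k zero) (λ k → cong (_* P k zero) (P′₀≡0 k)) ⟨
  (P′ ⊗ P) zero zero                      ≡⟨ P′P≐I zero zero ⟩
  + 1                                     ∎)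
  where
  open ≡-Reasoning
  P′₀≡0 : ∀ k → P′ zero k ≡ + 0
  P′₀≡0 k = i*j≡0⇒i≡0 (P′ zero k) (e≢0 k) (first-row-annihilates A P P′ Q e P′P≐I PXQ≐D k)
  0≢1 : + 0 ≢ + 1
  0≢1 ()

entries : ∀ {n} → List ℕ → Fin n → ℤ
entries ds i = + nth0 ds (toℕ i)

nth0-beyond : ∀ ds {k} → length ds ℕ.≤ k → nth0 ds k ≡ 0
nth0-beyond []       _         = refl
nth0-beyond (d ∷ ds) (s≤s len≤k) = nth0-beyond ds len≤k

nth0-positive : ∀ {ds} → All (1 ℕ.≤_) ds → ∀ {k} → k ℕ.< length ds → 1 ℕ.≤ nth0 ds k
nth0-positive (1≤d ∷ _)    {zero}  _           = 1≤d
nth0-positive (_ ∷ 1≤ds)   {suc k} (s≤s k<len) = nth0-positive 1≤ds k<len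

diagMat-diag : ∀ {n} ds → diagMat {n} ds ≐ diag (entries ds)
diagMat-diag ds i j with toℕ i ℕ.≟ toℕ j
... | yes i≡j = begin
  entries ds i                 ≡⟨ *-identityˡ _ ⟨
  + 1 * entries ds i           ≡⟨ cong (_* entries ds i) (δ-refl i) ⟨
  δ i i * entries ds i         ≡⟨ cong (λ k → δ i k * entries ds k) (Fin.toℕ-injective i≡j) ⟩
  δ i j * entries ds j         ∎
  where open ≡-Reasoning
... | no  i≢j = cong (_* entries ds j) (sym (δ-≢ (i≢j ∘′ cong toℕ)))

δ-permute : ∀ {n} (π : Permutation′ n) i j → δ (π ⟨$⟩ʳ i) (π ⟨$⟩ʳ j) ≡ δ i j
δ-permute π i j with i Fin.≟ j
... | yes refl = trans (δ-refl (π ⟨$⟩ʳ i)) (sym (δ-refl i))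
... | no  i≢j  = trans (δ-≢ (λ πi≡πj → i≢j (trans (sym (Perm.inverseˡ π)) (trans (cong (π ⟨$⟩ˡ_) πi≡πj) (Perm.inverseˡ π))))) (sym (δ-≢ i≢j))

reindex-diag : ∀ {n} (π : Permutation′ n) (e : Fin n → ℤ) → reindex (π ⟨$⟩ʳ_) (diag e) ≐ diag (λ i → e (π ⟨$⟩ʳ i))
reindex-diag π e i j = cong (_* e (π ⟨$⟩ʳ j)) (δ-permute π i j)

toℕ-punchIn-fromℕ : ∀ m (i : Fin m) → toℕ (punchIn (fromℕ m) i) ≡ toℕ i
toℕ-punchIn-fromℕ (suc m) zero    = refl
toℕ-punchIn-fromℕ (suc m) (suc i) = cong suc (toℕ-punchIn-fromℕ m i)

diagMat-∼-zero∷ : ∀ {m} ds → length ds ℕ.≤ m → diagMat {suc m} ds ∼ diag (+ 0 ∷ᵥ entries {m} ds)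
diagMat-∼-zero∷ {m} ds len≤m =
  ∼-trans (∼-reflexive (diagMat-diag ds))
    (∼-trans (∼-permute lastToFront (diag (entries ds)))
      (∼-reflexive (≐-trans (reindex-diag lastToFront (entries ds)) (diag-cong entries-moved))))
  where
  lastToFront : Permutation′ (suc m)
  lastToFront = Perm.insert zero (fromℕ m) Perm.id
  entries-moved : ∀ i → entries ds (lastToFront ⟨$⟩ʳ i) ≡ (+ 0 ∷ᵥ entries ds) i
  entries-moved zero    = cong +_ (trans (cong (nth0 ds) (Fin.toℕ-fromℕ m)) (nth0-beyond ds len≤m))
  entries-moved (suc i) = cong (λ k → + nth0 ds k) (toℕ-punchIn-fromℕ m i)

border₀-diag : ∀ {m} (e : Fin m → ℤ) → border (+ 0) (diag e) ≐ diag (+ 0 ∷ᵥ e)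
border₀-diag e zero    zero    = refl
border₀-diag e zero    (suc j) = refl
border₀-diag e (suc i) zero    = refl
border₀-diag e (suc i) (suc j) = refl

NonzeroInvariantFactors-cong : ∀ {n} {A B : Mat n} ds → A ∼ B → NonzeroInvariantFactors A ds ⇔ NonzeroInvariantFactors B ds
NonzeroInvariantFactors-cong ds A∼B = mk⇔
  (λ (len , positive , divisible , A∼D) → len , positive , divisible , ∼⇒Σ (∼-trans (∼-sym A∼B) (Σ⇒∼ A∼D)))
  (λ (len , positive , divisible , B∼D) → len , positive , divisible , ∼⇒Σ (∼-trans A∼B (Σ⇒∼ B∼D)))

NonzeroInvariantFactors-border₀ : ∀ {m} (N : Mat m) ds →
  NonzeroInvariantFactors (border (+ 0) N) ds ⇔ NonzeroInvariantFactors N ds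
NonzeroInvariantFactors-border₀ {m} N ds = mk⇔ shrink extend
  where
  shrink : NonzeroInvariantFactors (border (+ 0) N) ds → NonzeroInvariantFactors N ds
  shrink (_ , positive , divisible , X∼D) = len≤m , positive , divisible ,
    ∼⇒Σ (∼-trans (cancel-border₀ N (entries ds) (∼-trans (Σ⇒∼ X∼D) (diagMat-∼-zero∷ ds len≤m)))
                 (∼-reflexive (≐-sym (diagMat-diag ds))))
    where
    nonzero : ¬ length ds ℕ.≤ m → ∀ j → entries ds j ≢ + 0
    nonzero len≰m j = ℕ.>⇒≢ (nth0-positive positive (ℕ.<-≤-trans (Fin.toℕ<n j) (ℕ.≰⇒> len≰m))) ∘′ +-injective
    len≤m : length ds ℕ.≤ m
    len≤m with length ds ℕ.≤? m
    ... | yes len≤m = len≤m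
    ... | no  len≰m = ⊥-elim (border₀-≁-invertible-diag N (entries ds) (nonzero len≰m)
                                (∼-trans (Σ⇒∼ X∼D) (∼-reflexive (diagMat-diag ds))))
  extend : NonzeroInvariantFactors N ds → NonzeroInvariantFactors (border (+ 0) N) ds
  extend (len≤m , positive , divisible , N∼D) = ℕ.m≤n⇒m≤1+n len≤m , positive , divisible ,
    ∼⇒Σ (∼-trans (∼-border (Σ⇒∼ N∼D))
          (∼-trans (∼-reflexive (≐-trans (border-cong (+ 0) (diagMat-diag ds)) (border₀-diag (entries ds))))
            (∼-sym (diagMat-∼-zero∷ ds len≤m))))

-- Blow-ups as iterated duplication of vertices

∼-split-zero-cross : ∀ {m} (p : Fin (suc m)) (Z : Mat (suc m)) → (∀ j → Z p j ≡ + 0) → (∀ i → Z i p ≡ + 0) →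
  Z ∼ border (+ 0) (reindex (punchIn p) Z)
∼-split-zero-cross p Z row≡0 col≡0 =
  ∼-trans (∼-permute (Perm.insert zero p Perm.id) Z) (∼-reflexive moved)
  where
  moved : reindex (Perm.insert zero p Perm.id ⟨$⟩ʳ_) Z ≐ border (+ 0) (reindex (punchIn p) Z)
  moved zero    zero    = row≡0 p
  moved zero    (suc j) = row≡0 (punchIn p j)
  moved (suc i) zero    = col≡0 (punchIn p i)
  moved (suc i) (suc j) = refl

-- Subtract row a from row b and column a from column b: the b-th row and column become zero.
∼-drop-repeated : ∀ {m} (D : Mat (suc m)) {a b : Fin (suc m)} → a ≢ b →
  (∀ j → D a j ≡ D b j) → (∀ i → D i a ≡ D i b) → D ∼ border (+ 0) (reindex (punchIn b) D)
∼-drop-repeated {m} D {a} {b} a≢b rows≡ cols≡ =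
  ∼-trans (equivalent Tr Tc (Unimodular-transvection b a -1ℤ (a≢b ∘′ sym)) (Unimodular-transvection a b -1ℤ a≢b) ≐-refl)
    (∼-trans (∼-split-zero-cross b Z Z-row Z-col) (∼-reflexive (border-cong (+ 0) Z-rest)))
  where
  x+1*[-1*x]≡0 : ∀ x → x + + 1 * (-1ℤ * x) ≡ + 0
  x+1*[-1*x]≡0 = solve-∀
  x+x*[-1*1]≡0 : ∀ x → x + x * (-1ℤ * + 1) ≡ + 0
  x+x*[-1*1]≡0 = solve-∀
  Tr Tc W Z : Mat (suc m)
  Tr = transvection b a -1ℤ
  Tc = transvection a b -1ℤ
  W = Tr ⊗ D
  Z = W ⊗ Tc
  W≡ : ∀ i j → W i j ≡ D i j + δ i b * (-1ℤ * D a j)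
  W≡ = transvection-⊗ b a -1ℤ D
  Z≡ : ∀ i j → Z i j ≡ W i j + W i a * (-1ℤ * δ b j)
  Z≡ i = ᵥ⊗-transvection (W i) a b -1ℤ
  W-row : ∀ j → W b j ≡ + 0
  W-row j = begin
    W b j                               ≡⟨ W≡ b j ⟩
    D b j + δ b b * (-1ℤ * D a j)       ≡⟨ cong₂ (λ x y → D b j + x * (-1ℤ * y)) (δ-refl b) (rows≡ j) ⟩
    D b j + + 1 * (-1ℤ * D b j)         ≡⟨ x+1*[-1*x]≡0 (D b j) ⟩
    + 0                                 ∎
    where open ≡-Reasoning
  Z-row : ∀ j → Z b j ≡ + 0
  Z-row j = trans (Z≡ b j) (cong₂ (λ x y → x + y * (-1ℤ * δ b j)) (W-row j) (W-row a))
  Z-col : ∀ i → Z i b ≡ + 0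
  Z-col i = begin
    Z i b                                                                ≡⟨ Z≡ i b ⟩
    W i b + W i a * (-1ℤ * δ b b)                                        ≡⟨ cong (λ z → W i b + W i a * (-1ℤ * z)) (δ-refl b) ⟩
    W i b + W i a * (-1ℤ * + 1)                                          ≡⟨ cong₂ (λ x y → x + y * (-1ℤ * + 1)) (W≡ i b) (W≡ i a) ⟩
    D i b + δ i b * (-1ℤ * D a b) + (D i a + δ i b * (-1ℤ * D a a)) * (-1ℤ * + 1)
                                                                         ≡⟨ cong₂ (λ x y → D i b + δ i b * (-1ℤ * D a b) + (x + δ i b * (-1ℤ * y)) * (-1ℤ * + 1)) (cols≡ i) (cols≡ a) ⟩
    D i b + δ i b * (-1ℤ * D a b) + (D i b + δ i b * (-1ℤ * D a b)) * (-1ℤ * + 1)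
                                                                         ≡⟨ x+x*[-1*1]≡0 (D i b + δ i b * (-1ℤ * D a b)) ⟩
    + 0                                                                  ∎
    where open ≡-Reasoning
  Z-rest : reindex (punchIn b) Z ≐ reindex (punchIn b) D
  Z-rest i j = begin
    Z (punchIn b i) (punchIn b j)
      ≡⟨ Z≡ (punchIn b i) (punchIn b j) ⟩
    W (punchIn b i) (punchIn b j) + W (punchIn b i) a * (-1ℤ * δ b (punchIn b j))
      ≡⟨ cong (λ x → W (punchIn b i) (punchIn b j) + W (punchIn b i) a * (-1ℤ * x)) (δ-≢ (Fin.punchInᵢ≢i b j ∘′ sym)) ⟩
    W (punchIn b i) (punchIn b j) + W (punchIn b i) a * (-1ℤ * + 0)
      ≡⟨ x+y*[z*0]≡x (W (punchIn b i) (punchIn b j)) (W (punchIn b i) a) -1ℤ ⟩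
    W (punchIn b i) (punchIn b j)
      ≡⟨ W≡ (punchIn b i) (punchIn b j) ⟩
    D (punchIn b i) (punchIn b j) + δ (punchIn b i) b * (-1ℤ * D a (punchIn b j))
      ≡⟨ cong (λ x → D (punchIn b i) (punchIn b j) + x * (-1ℤ * D a (punchIn b j))) (δ-≢ (Fin.punchInᵢ≢i b i)) ⟩
    D (punchIn b i) (punchIn b j) + + 0 * (-1ℤ * D a (punchIn b j))
      ≡⟨ +-identityʳ _ ⟩
    D (punchIn b i) (punchIn b j) ∎
    where open ≡-Reasoning

pinch-inject₁ : ∀ {m} (k : Fin (suc m)) → pinch k (inject₁ k) ≡ k
pinch-inject₁ zero            = refl
pinch-inject₁ {suc m} (suc k) = cong suc (pinch-inject₁ k)

pinch-suc : ∀ {m} (k : Fin (suc m)) → pinch k (suc k) ≡ k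
pinch-suc zero            = refl
pinch-suc {suc m} (suc k) = cong suc (pinch-suc k)

pinch-punchIn : ∀ {m} (k i : Fin (suc m)) → pinch k (punchIn (suc k) i) ≡ i
pinch-punchIn zero            zero    = refl
pinch-punchIn zero            (suc i) = refl
pinch-punchIn {suc m} (suc k) zero    = refl
pinch-punchIn {suc m} (suc k) (suc i) = cong suc (pinch-punchIn k i)

inject₁≢suc : ∀ {m} (k : Fin m) → inject₁ k ≢ suc k
inject₁≢suc k eq = ℕ.1+n≢n (trans (sym (cong toℕ eq)) (Fin.toℕ-inject₁ k))

∼-reindex-pinch : ∀ {m} (k : Fin (suc m)) (N : Mat (suc m)) → reindex (pinch k) N ∼ border (+ 0) N
∼-reindex-pinch k N =
  ∼-trans (∼-drop-repeated (reindex (pinch k) N) (inject₁≢suc k) (λ j → cong (λ x → N x (pinch k j)) same)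
                                                                (λ i → cong (N (pinch k i)) same))
          (∼-reflexive (border-cong (+ 0) (λ i j → cong₂ N (pinch-punchIn k i) (pinch-punchIn k j))))
  where
  same : pinch k (inject₁ k) ≡ pinch k (suc k)
  same = trans (pinch-inject₁ k) (sym (pinch-suc k))

data Duplicating : ∀ {N n} → (Fin N → Fin n) → Set where
  identity : ∀ {n} → Duplicating {n} {n} id
  _∘pinch_ : ∀ {m n} {f : Fin (suc m) → Fin n} → Duplicating f → (k : Fin (suc m)) → Duplicating (f ∘′ pinch k)
  resp-≗   : ∀ {N n} {f g : Fin N → Fin n} → (∀ x → f x ≡ g x) → Duplicating f → Duplicating g

Duplicating-∘ : ∀ {N n p} {g : Fin n → Fin p} {f : Fin N → Fin n} → Duplicating g → Duplicating f → Duplicating (g ∘′ f)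
Duplicating-∘ dg identity               = dg
Duplicating-∘ dg (df ∘pinch k)          = Duplicating-∘ dg df ∘pinch k
Duplicating-∘ {g = g} dg (resp-≗ f≗f′ df) = resp-≗ (λ x → cong g (f≗f′ x)) (Duplicating-∘ dg df)

Duplicating-lift : ∀ {N n} {f : Fin N → Fin n} → Duplicating f → Duplicating (lift 1 f)
Duplicating-lift identity        = resp-≗ (λ { zero → refl ; (suc x) → refl }) identity
Duplicating-lift (df ∘pinch k)   = resp-≗ (λ { zero → refl ; (suc x) → refl }) (Duplicating-lift df ∘pinch suc k)
Duplicating-lift (resp-≗ f≗g df) = resp-≗ (λ { zero → refl ; (suc x) → cong suc (f≗g x) }) (Duplicating-lift df)

collapse : ∀ a {T} → Fin (a ℕ.+ T) → Fin (suc T)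
collapse a x = [ (λ _ → zero) , suc ]′ (splitAt a x)

Duplicating-collapse : ∀ a {T} → 1 ℕ.≤ a → Duplicating (collapse a {T})
Duplicating-collapse (suc zero)    _ = resp-≗ (λ { zero → refl ; (suc x) → refl }) identity
Duplicating-collapse (suc (suc c)) _ = resp-≗ collapse-pinch (Duplicating-collapse (suc c) (s≤s ℕ.z≤n) ∘pinch zero)
  where
  collapse-pinch : ∀ x → collapse (suc c) (pinch zero x) ≡ collapse (suc (suc c)) x
  collapse-pinch zero    = refl
  collapse-pinch (suc x) with splitAt (suc c) x
  ... | inj₁ _ = refl
  ... | inj₂ _ = refl

owner-collapse : ∀ {n} (d : Fin (suc n) → ℕ) x → lift 1 (owner (d ∘′ suc)) (collapse (d zero) x) ≡ owner d x
owner-collapse d x with splitAt (d zero) x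
... | inj₁ _ = refl
... | inj₂ _ = refl

Duplicating-owner : ∀ {n} (d : Fin n → ℕ) → (∀ u → 1 ℕ.≤ d u) → Duplicating (owner d)
Duplicating-owner {zero}  d _    = resp-≗ (λ ()) identity
Duplicating-owner {suc n} d d≥1 =
  resp-≗ (owner-collapse d) (Duplicating-∘ (Duplicating-lift (Duplicating-owner (d ∘′ suc) (λ u → d≥1 (suc u))))
                                         (Duplicating-collapse (d zero) (d≥1 zero)))

PreservesInvariantFactors : ∀ {N n} → (Fin N → Fin n) → Set
PreservesInvariantFactors f = ∀ M ds → NonzeroInvariantFactors (reindex f M) ds ⇔ NonzeroInvariantFactors M ds

Duplicating⇒PreservesInvariantFactors : ∀ {N n} {f : Fin N → Fin n} → Duplicating f → PreservesInvariantFactors f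
Duplicating⇒PreservesInvariantFactors identity M ds = ⇔-id _
Duplicating⇒PreservesInvariantFactors (_∘pinch_ {f = f} df k) M ds =
  Duplicating⇒PreservesInvariantFactors df M ds
  ⇔-∘ (NonzeroInvariantFactors-border₀ (reindex f M) ds ⇔-∘ NonzeroInvariantFactors-cong ds (∼-reindex-pinch k (reindex f M)))
Duplicating⇒PreservesInvariantFactors (resp-≗ f≗g df) M ds =
  Duplicating⇒PreservesInvariantFactors df M ds
  ⇔-∘ NonzeroInvariantFactors-cong ds (∼-reflexive λ i j → cong₂ M (sym (f≗g i)) (sym (f≗g j)))

mainTheorem13 : ∀ {n} (G : SimpleGraph n) (d : Fin n → ℕ) → (∀ u → 1 ≤ d u) →
    ∀ (ds : List ℕ) →
      NonzeroInvariantFactors (adjMat G) ds ⇔ NonzeroInvariantFactors (adjMat (blowUp G d)) ds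
mainTheorem13 G d d≥1 ds = ⇔-sym (Duplicating⇒PreservesInvariantFactors (Duplicating-owner d d≥1) (adjMat G) ds)
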